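{- Let $a\neq0$ be a complex number. For $m,n\in\mathbb{N}$ with $m\le n$, \[ \binom{n-1}{m-1}B_{n-m}^{(-m+1)}(1)=(n-1)!\sum_{k=0}^{n-m}\frac{\binom{ -an}{n-k-m}\binom{k+m-1}{k}}{(k+m-1)!}B_k^{(k-n+1)}(an+1). \]
   Context: For real $r$ (including nonpositive $r$), the Bernoulli polynomials of order $r$ are defined by $\left(\frac{t}{e^t-1}\right)^re^{xt}=\sum_{n\ge0}B_n^{(r)}(x)\frac{t^n}{n!}$ as formal power series. For complex $z$ and integer $j\ge0$, $\binom{z}{j}=z(z-1)\cdots(z-j+1)/j!$. -}

module Defs where

open import Level using (Level)
open import Data.Nat as ℕ using (ℕ; zero; suc; _∸_; _!)
open import Data.Integer as ℤ using (ℤ; +_; -[1+_])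
open import Data.Rational as ℚ using (ℚ)
open import Algebra.Bundles using (CommutativeRing)
open import Data.List using (List; []; _∷_)

invFact : ℕ → ℚ
invFact zero    = ℚ.1ℚ
invFact (suc j) = invFact j ℚ.* (+ 1 ℚ./ suc j)

-- Everything below lives in a commutative ring R equipped with a map
-- ι : ℚ → R (in the statement ι is required to be a ring homomorphism,
-- i.e. R is a ℚ-algebra; ℂ is the case of the paper).
module Bernoulli {c ℓ : Level} (R : CommutativeRing c ℓ)
                 (ι : ℚ → CommutativeRing.Carrier R) where
  open CommutativeRing R

  nat : ℕ → Carrier
  nat k = ι (+ k ℚ./ 1)

  sumTo : ℕ → (ℕ → Carrier) → Carrier
  sumTo zero    f = f 0
  sumTo (suc N) f = sumTo N f + f (suc N)

  Series : Set c
  Series = ℕ → Carrier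

  _⊛_ : Series → Series → Series
  (f ⊛ g) n = sumTo n (λ i → f i * g (n ∸ i))

  one : Series
  one zero    = 1#
  one (suc _) = 0#

  pow : Series → ℕ → Series
  pow f zero    = one
  pow f (suc s) = pow f s ⊛ f

  -- (e^t - 1)/t = Σ_j t^j/(j+1)!
  E : Series
  E j = ι (invFact (suc j))

  -- t/(e^t - 1): the multiplicative inverse of E (note E 0 = 1), given by
  -- the usual recursion  D 0 = 1,  D (n+1) = - Σ_{i=1}^{n+1} E i * D (n+1-i).
  -- revD n is the list [D n, D (n-1), ..., D 0].
  dotE : ℕ → List Carrier → Carrier
  dotE i []       = 0#
  dotE i (x ∷ xs) = E i * x + dotE (suc i) xs

  revD : ℕ → List Carrier
  revD zero    = 1# ∷ []
  revD (suc n) = (- dotE 1 (revD n)) ∷ revD n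

  D : Series
  D n with revD n
  ... | []    = 0#
  ... | x ∷ _ = x

  -- (t/(e^t-1))^r for integer r
  kernel : ℤ → Series
  kernel (+ r)      = pow D r
  kernel -[1+ s ]   = pow E (suc s)

  power : Carrier → ℕ → Carrier
  power x zero    = 1#
  power x (suc j) = power x j * x

  expS : Carrier → Series
  expS x j = power x j * ι (invFact j)

  -- Bernoulli polynomial of (integer) order r:
  -- (t/(e^t-1))^r e^{xt} = Σ_n B_n^{(r)}(x) t^n/n!
  B : ℤ → ℕ → Carrier → Carrier
  B r n x = nat (n !) * (kernel r ⊛ expS x) n

  fallingFact : Carrier → ℕ → Carrier
  fallingFact z zero    = 1#
  fallingFact z (suc j) = fallingFact z j * (z - nat j)

  binom : Carrier → ℕ → Carrier
  binom z j = fallingFact z j * ι (invFact j)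

module Submission where

-- Write E(t) = (e^t - 1)/t, so that (t/(e^t-1))^(-t) = E^t and
-- B_n^(-t)(x) = n! [t^n] E^t e^(xt) for every t ∈ ℕ.  With m = s+1 and
-- n = s+p+1 both Bernoulli polynomials in the theorem have nonpositive order,
-- and after clearing the factorials (C(k+s,k) k!/(k+s)! = 1/s!) the theorem
-- becomes, for y = a·n,
--     [t^p] E^s e^t = Σ_{k≤p} C(-y, p-k) [t^k] E^(s+p-k) e^((y+1)t).
-- This follows from e^t = e^((y+1)t) e^(-yt) and the binomial series
--     e^(zt) = Σ_j C(z,j) (e^t - 1)^j = Σ_j C(z,j) t^j E^j,
-- which holds in every ℚ-algebra: both sides F satisfy F' = zF and F(0) = 1.

open import Defs
open import Data.Nat as ℕ using (ℕ; _∸_; _!; zero; suc; z≤n; s≤s)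
open import Data.Nat.Combinatorics using (_C_)
open import Data.Integer as ℤ using (+_)
open import Data.Rational using (ℚ)
open import Data.Rational.Properties using (+-*-rawRing)
open import Algebra.Bundles using (CommutativeRing)
open import Algebra.Morphism.Structures using (IsRingHomomorphism)
open import Relation.Nullary using (¬_)

open import Data.Product using (_,_)
open import Data.Sum using (inj₁; inj₂)
open import Relation.Binary.Bundles using (Setoid)
open import Relation.Binary.PropositionalEquality as Eq using (_≡_)
import Data.Nat.Properties as ℕP
import Data.Nat.Combinatorics as ℕC
import Data.Nat.DivMod as ℕD
import Data.Integer.Properties as ℤP
open import Data.Integer.Tactic.RingSolver using (solve-∀)
import Data.Rational as ℚ
import Data.Rational.Properties as ℚP
import Data.Rational.Unnormalised as ℚᵘ
import Data.Rational.Unnormalised.Properties as ℚᵘP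
import Relation.Binary.Reasoning.Setoid as SetoidReasoning
import Algebra.Solver.Ring.NaturalCoefficients.Default as NatCoeffSolver

choose-factorials : ∀ a b → ((a ℕ.+ b) C a) ℕ.* (a ! ℕ.* b !) ≡ (a ℕ.+ b) !
choose-factorials a b =
  Eq.trans (Eq.cong (λ c → ((a ℕ.+ b) C a) ℕ.* (a ! ℕ.* c !)) (Eq.sym (ℕP.m+n∸m≡n a b)))
    (Eq.trans (Eq.cong (ℕ._* (a ! ℕ.* (a ℕ.+ b ∸ a) !)) (ℕC.nCk≡n!/k![n-k]! a≤a+b))
      (ℕD.m/n*n≡m (ℕC.k![n∸k]!∣n! a≤a+b)))
  where
  a≤a+b = ℕP.m≤m+n a b
  instance
    _ = ℕP._!≢0 a
    _ = ℕP._!≢0 (a ℕ.+ b ∸ a)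
    _ = ℕP.m*n≢0 (a !) ((a ℕ.+ b ∸ a) !)

-- The order 1 - m of the left-hand Bernoulli polynomial, for m = s+1.
order-left : ∀ s → + 1 ℤ.- + suc s ≡ ℤ.- (+ s)
order-left zero    = Eq.refl
order-left (suc s) = Eq.refl

-- The order k - n + 1 of the right-hand Bernoulli polynomials, for k ≤ N = n - 1.
order-right : ∀ {k N} → k ℕ.≤ N → (+ k ℤ.- + suc N) ℤ.+ + 1 ≡ ℤ.- (+ (N ∸ k))
order-right {k} {N} k≤N =
  Eq.trans (Eq.cong (λ w → (+ k ℤ.- + suc w) ℤ.+ + 1) (Eq.sym (ℕP.m+[n∸m]≡n k≤N)))
    (Eq.trans (Eq.cong (λ w → (+ k ℤ.- w) ℤ.+ + 1)
                (Eq.trans (ℤP.pos-+ 1 (k ℕ.+ t)) (Eq.cong (λ w → + 1 ℤ.+ w) (ℤP.pos-+ k t))))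
      (solved (+ k) (+ t)))
  where
  t = N ∸ k
  solved : ∀ (x y : ℤ.ℤ) → (x ℤ.- (+ 1 ℤ.+ (x ℤ.+ y))) ℤ.+ + 1 ≡ ℤ.- y
  solved = solve-∀

-- The remaining indices of the theorem's summand, for n = s+p+1 and m = s+1.
index-binom : ∀ s p k → suc (s ℕ.+ p) ∸ k ∸ suc s ≡ p ∸ k
index-binom s p k = Eq.trans (ℕP.∸-+-assoc (suc (s ℕ.+ p)) k (suc s))
  (Eq.trans (Eq.cong (suc (s ℕ.+ p) ∸_) (Eq.trans (ℕP.+-suc k s) (Eq.cong suc (ℕP.+-comm k s))))
    (ℕP.[m+n]∸[m+o]≡n∸o s p k))

index-choose : ∀ s k → k ℕ.+ suc s ∸ 1 ≡ k ℕ.+ s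
index-choose s k = Eq.cong (_∸ 1) (ℕP.+-suc k s)

natℚ : ℕ → ℚ
natℚ k = + k ℚ./ 1

fromℚᵘ-homo-+ : ∀ p q → ℚ.fromℚᵘ (p ℚᵘ.+ q) ≡ ℚ.fromℚᵘ p ℚ.+ ℚ.fromℚᵘ q
fromℚᵘ-homo-+ p q = ℚP.toℚᵘ-injective (ℚᵘP.≃-trans (ℚP.toℚᵘ-fromℚᵘ (p ℚᵘ.+ q))
  (ℚᵘP.≃-sym (ℚᵘP.≃-trans (ℚP.toℚᵘ-homo-+ (ℚ.fromℚᵘ p) (ℚ.fromℚᵘ q))
    (ℚᵘP.+-cong (ℚP.toℚᵘ-fromℚᵘ p) (ℚP.toℚᵘ-fromℚᵘ q)))))

fromℚᵘ-homo-* : ∀ p q → ℚ.fromℚᵘ (p ℚᵘ.* q) ≡ ℚ.fromℚᵘ p ℚ.* ℚ.fromℚᵘ q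
fromℚᵘ-homo-* p q = ℚP.toℚᵘ-injective (ℚᵘP.≃-trans (ℚP.toℚᵘ-fromℚᵘ (p ℚᵘ.* q))
  (ℚᵘP.≃-sym (ℚᵘP.≃-trans (ℚP.toℚᵘ-homo-* (ℚ.fromℚᵘ p) (ℚ.fromℚᵘ q))
    (ℚᵘP.*-cong (ℚP.toℚᵘ-fromℚᵘ p) (ℚP.toℚᵘ-fromℚᵘ q)))))

natℚ-+ : ∀ a b → natℚ (a ℕ.+ b) ≡ natℚ a ℚ.+ natℚ b
natℚ-+ a b = Eq.trans (ℚP.fromℚᵘ-cong {ℚᵘ.mkℚᵘ (+ (a ℕ.+ b)) 0} {ℚᵘ.mkℚᵘ (+ a) 0 ℚᵘ.+ ℚᵘ.mkℚᵘ (+ b) 0}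
                          (ℚᵘ.*≡* (Eq.trans (Eq.cong (ℤ._* + 1) (ℤP.pos-+ a b)) (cross (+ a) (+ b)))))
                      (fromℚᵘ-homo-+ (ℚᵘ.mkℚᵘ (+ a) 0) (ℚᵘ.mkℚᵘ (+ b) 0))
  where
  cross : ∀ (x y : ℤ.ℤ) → (x ℤ.+ y) ℤ.* + 1 ≡ (x ℤ.* + 1 ℤ.+ y ℤ.* + 1) ℤ.* + 1
  cross = solve-∀

natℚ-* : ∀ a b → natℚ (a ℕ.* b) ≡ natℚ a ℚ.* natℚ b
natℚ-* a b = Eq.trans (ℚP.fromℚᵘ-cong {ℚᵘ.mkℚᵘ (+ (a ℕ.* b)) 0} {ℚᵘ.mkℚᵘ (+ a) 0 ℚᵘ.* ℚᵘ.mkℚᵘ (+ b) 0}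
                          (ℚᵘ.*≡* (Eq.cong (ℤ._* + 1) (ℤP.pos-* a b))))
                      (fromℚᵘ-homo-* (ℚᵘ.mkℚᵘ (+ a) 0) (ℚᵘ.mkℚᵘ (+ b) 0))

natℚ-inverse : ∀ j → natℚ (suc j) ℚ.* (+ 1 ℚ./ suc j) ≡ ℚ.1ℚ
natℚ-inverse j = Eq.trans (Eq.sym (fromℚᵘ-homo-* (ℚᵘ.mkℚᵘ (+ suc j) 0) (ℚᵘ.mkℚᵘ (+ 1) j)))
                          (ℚP.fromℚᵘ-cong {ℚᵘ.mkℚᵘ (+ suc j) 0 ℚᵘ.* ℚᵘ.mkℚᵘ (+ 1) j} {ℚᵘ.1ℚᵘ}
                             (ℚᵘ.*≡* cross))
  where
  cross : (+ suc j ℤ.* + 1) ℤ.* + 1 ≡ + 1 ℤ.* + (suc (j ℕ.+ 0))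
  cross = Eq.trans (ℤP.*-identityʳ _) (Eq.trans (ℤP.*-identityʳ _)
            (Eq.sym (Eq.trans (ℤP.*-identityˡ _) (Eq.cong (λ i → + suc i) (ℕP.+-identityʳ j)))))

-- Finite sums and formal power series over a commutative ring R.  (The map ι
-- is a parameter only because Defs places sumTo and _⊛_ in Bernoulli R ι; no
-- property of ι is used here.)
module SeriesAlgebra {c ℓ} (R : CommutativeRing c ℓ) (ι : ℚ → CommutativeRing.Carrier R) where
  open CommutativeRing R
  open Bernoulli R ι
  open NatCoeffSolver commutativeSemiring using (solve; _:+_; _:*_; _:=_)

  sum-cong≤ : ∀ N {f g : ℕ → Carrier} → (∀ i → i ℕ.≤ N → f i ≈ g i) → sumTo N f ≈ sumTo N g
  sum-cong≤ zero    f≈g = f≈g 0 z≤n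
  sum-cong≤ (suc N) f≈g = +-cong (sum-cong≤ N (λ i i≤N → f≈g i (ℕP.m≤n⇒m≤1+n i≤N))) (f≈g (suc N) ℕP.≤-refl)

  sum-cong : ∀ N {f g : ℕ → Carrier} → (∀ i → f i ≈ g i) → sumTo N f ≈ sumTo N g
  sum-cong N f≈g = sum-cong≤ N (λ i _ → f≈g i)

  sum-+ : ∀ N (f g : ℕ → Carrier) → sumTo N (λ i → f i + g i) ≈ sumTo N f + sumTo N g
  sum-+ zero    f g = refl
  sum-+ (suc N) f g = trans (+-congʳ (sum-+ N f g))
    (solve 4 (λ a b d e → (a :+ b) :+ (d :+ e) := (a :+ d) :+ (b :+ e)) refl _ _ _ _)

  sum-*ˡ : ∀ N x (f : ℕ → Carrier) → x * sumTo N f ≈ sumTo N (λ i → x * f i)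
  sum-*ˡ zero    x f = refl
  sum-*ˡ (suc N) x f = trans (distribˡ x _ _) (+-congʳ (sum-*ˡ N x f))

  sum-*ʳ : ∀ N x (f : ℕ → Carrier) → sumTo N f * x ≈ sumTo N (λ i → f i * x)
  sum-*ʳ N x f = trans (*-comm _ x) (trans (sum-*ˡ N x f) (sum-cong N (λ i → *-comm x (f i))))

  sum-zero : ∀ N {f : ℕ → Carrier} → (∀ i → i ℕ.≤ N → f i ≈ 0#) → sumTo N f ≈ 0#
  sum-zero N f≈0 = trans (sum-cong≤ N f≈0) (vanish N)
    where
    vanish : ∀ N → sumTo N (λ _ → 0#) ≈ 0#
    vanish zero    = refl
    vanish (suc N) = trans (+-congʳ (vanish N)) (+-identityˡ 0#)

  sum-first : ∀ N (f : ℕ → Carrier) → sumTo (suc N) f ≈ f 0 + sumTo N (λ i → f (suc i))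
  sum-first zero    f = refl
  sum-first (suc N) f = trans (+-congʳ (sum-first N f)) (+-assoc _ _ _)

  sum-truncate : ∀ M N {f : ℕ → Carrier} → M ℕ.≤ N → (∀ j → M ℕ.< j → j ℕ.≤ N → f j ≈ 0#) →
                 sumTo N f ≈ sumTo M f
  sum-truncate M zero    z≤n  _   = refl
  sum-truncate M (suc N) M≤1+N f≈0 with ℕP.m≤n⇒m<n∨m≡n M≤1+N
  ... | inj₂ Eq.refl       = refl
  ... | inj₁ (s≤s M≤N) =
    trans (+-cong (sum-truncate M N M≤N (λ j M<j j≤N → f≈0 j M<j (ℕP.m≤n⇒m≤1+n j≤N)))
                  (f≈0 (suc N) (s≤s M≤N) ℕP.≤-refl))
          (+-identityʳ _)

  sum-shift : ∀ n (h : ℕ → Carrier) → h 0 ≈ 0# → h (suc n) ≈ 0# → sumTo n (λ i → h (suc i)) ≈ sumTo n h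
  sum-shift n h h0≈0 hn≈0 = begin
    sumTo n (λ i → h (suc i))       ≈⟨ +-identityˡ _ ⟨
    0# + sumTo n (λ i → h (suc i))  ≈⟨ +-congʳ h0≈0 ⟨
    h 0 + sumTo n (λ i → h (suc i)) ≈⟨ sum-first n h ⟨
    sumTo n h + h (suc n)           ≈⟨ +-congˡ hn≈0 ⟩
    sumTo n h + 0#                  ≈⟨ +-identityʳ _ ⟩
    sumTo n h                       ∎
    where open SetoidReasoning setoid

  sum-swap : ∀ N M (h : ℕ → ℕ → Carrier) →
             sumTo N (λ i → sumTo M (h i)) ≈ sumTo M (λ j → sumTo N (λ i → h i j))
  sum-swap zero    M h = refl
  sum-swap (suc N) M h =
    trans (+-congʳ (sum-swap N M h)) (sym (sum-+ M (λ j → sumTo N (λ i → h i j)) (h (suc N))))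

  sum-triangle : ∀ N (H : ℕ → ℕ → Carrier) →
    sumTo N (λ n → sumTo n (H n)) ≈ sumTo N (λ i → sumTo (N ∸ i) (λ j → H (i ℕ.+ j) i))
  sum-triangle zero    H = refl
  sum-triangle (suc N) H = begin
    sumTo N (λ n → sumTo n (H n)) + (sumTo N (H (suc N)) + H (suc N) (suc N))
      ≈⟨ +-congʳ (sum-triangle N H) ⟩
    sumTo N (λ i → sumTo (N ∸ i) (λ j → H (i ℕ.+ j) i)) + (sumTo N (H (suc N)) + H (suc N) (suc N))
      ≈⟨ +-assoc _ _ _ ⟨
    (sumTo N (λ i → sumTo (N ∸ i) (λ j → H (i ℕ.+ j) i)) + sumTo N (H (suc N))) + H (suc N) (suc N)
      ≈⟨ +-cong (sum-+ N _ _) (reflexive (Eq.cong (λ k → H k (suc N)) (ℕP.+-identityʳ (suc N)))) ⟨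
    sumTo N (λ i → sumTo (N ∸ i) (λ j → H (i ℕ.+ j) i) + H (suc N) i) + H (suc N ℕ.+ 0) (suc N)
      ≈⟨ +-cong (sum-cong≤ N row) (reflexive (Eq.cong (λ k → sumTo k (λ j → H (suc N ℕ.+ j) (suc N)))
                                                       (Eq.sym (ℕP.n∸n≡0 N)))) ⟩
    sumTo (suc N) (λ i → sumTo (suc N ∸ i) (λ j → H (i ℕ.+ j) i)) ∎
    where
    open SetoidReasoning setoid
    -- row i of the triangle gains the term with n = N+1
    row : ∀ i → i ℕ.≤ N →
          sumTo (N ∸ i) (λ j → H (i ℕ.+ j) i) + H (suc N) i ≈ sumTo (suc N ∸ i) (λ j → H (i ℕ.+ j) i)
    row i i≤N rewrite ℕP.+-∸-assoc 1 i≤N =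
      +-congˡ (reflexive (Eq.cong (λ k → H k i)
        (Eq.sym (Eq.trans (ℕP.+-suc i (N ∸ i)) (Eq.cong suc (ℕP.m+[n∸m]≡n i≤N))))))

  sum-reverse : ∀ N (f : ℕ → Carrier) → sumTo N f ≈ sumTo N (λ i → f (N ∸ i))
  sum-reverse zero    f = refl
  sum-reverse (suc N) f =
    trans (+-congʳ (sum-reverse N f)) (trans (+-comm _ _) (sym (sum-first N (λ i → f (suc N ∸ i)))))

  infix 4 _≋_
  record _≋_ (f g : Series) : Set ℓ where
    constructor mk≋
    field at : ∀ n → f n ≈ g n
  open _≋_ public

  ≋-setoid : Setoid c ℓ
  ≋-setoid = record
    { Carrier       = Series
    ; _≈_           = _≋_
    ; isEquivalence = record
      { refl  = mk≋ λ _ → refl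
      ; sym   = λ f≋g → mk≋ λ n → sym (at f≋g n)
      ; trans = λ f≋g g≋h → mk≋ λ n → trans (at f≋g n) (at g≋h n)
      }
    }
  open Setoid ≋-setoid public using () renaming (refl to ≋-refl; sym to ≋-sym; trans to ≋-trans)

  infixl 6 _+ₛ_
  _+ₛ_ : Series → Series → Series
  (f +ₛ g) n = f n + g n

  infixr 7 _·ₛ_
  _·ₛ_ : Carrier → Series → Series
  (x ·ₛ f) n = x * f n

  ⊛-cong : ∀ {f f′ g g′} → f ≋ f′ → g ≋ g′ → (f ⊛ g) ≋ (f′ ⊛ g′)
  ⊛-cong f≋f′ g≋g′ = mk≋ λ n → sum-cong n (λ i → *-cong (at f≋f′ i) (at g≋g′ (n ∸ i)))

  ⊛-comm : ∀ f g → (f ⊛ g) ≋ (g ⊛ f)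
  ⊛-comm f g = mk≋ λ n → trans (sum-reverse n (λ i → f i * g (n ∸ i)))
    (sum-cong≤ n (λ i i≤n → trans (*-comm _ _) (*-congʳ (reflexive (Eq.cong g (ℕP.m∸[m∸n]≡n i≤n))))))

  ⊛-assoc : ∀ f g h → ((f ⊛ g) ⊛ h) ≋ (f ⊛ (g ⊛ h))
  ⊛-assoc f g h = mk≋ coeff
    where
    open SetoidReasoning setoid
    coeff : ∀ N → ((f ⊛ g) ⊛ h) N ≈ (f ⊛ (g ⊛ h)) N
    coeff N = begin
      sumTo N (λ n → sumTo n (λ i → f i * g (n ∸ i)) * h (N ∸ n))
        ≈⟨ sum-cong N (λ n → sum-*ʳ n (h (N ∸ n)) (λ i → f i * g (n ∸ i))) ⟩
      sumTo N (λ n → sumTo n (λ i → f i * g (n ∸ i) * h (N ∸ n)))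
        ≈⟨ sum-triangle N (λ n i → f i * g (n ∸ i) * h (N ∸ n)) ⟩
      sumTo N (λ i → sumTo (N ∸ i) (λ j → f i * g ((i ℕ.+ j) ∸ i) * h (N ∸ (i ℕ.+ j))))
        ≈⟨ sum-cong N (λ i → trans (sum-cong (N ∸ i) (regroup i)) (sym (sum-*ˡ (N ∸ i) (f i) _))) ⟩
      sumTo N (λ i → f i * sumTo (N ∸ i) (λ j → g j * h (N ∸ i ∸ j))) ∎
      where
      regroup : ∀ i j → f i * g ((i ℕ.+ j) ∸ i) * h (N ∸ (i ℕ.+ j)) ≈ f i * (g j * h (N ∸ i ∸ j))
      regroup i j = trans (*-assoc _ _ _) (*-congˡ (*-cong (reflexive (Eq.cong g (ℕP.m+n∸m≡n i j)))
                                                          (reflexive (Eq.cong h (Eq.sym (ℕP.∸-+-assoc N i j))))))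

  ⊛-distribˡ : ∀ h f g → (h ⊛ (f +ₛ g)) ≋ ((h ⊛ f) +ₛ (h ⊛ g))
  ⊛-distribˡ h f g = mk≋ λ n → trans (sum-cong n (λ i → distribˡ _ _ _)) (sum-+ n _ _)

  ⊛-·ˡ : ∀ x f g → ((x ·ₛ f) ⊛ g) ≋ (x ·ₛ (f ⊛ g))
  ⊛-·ˡ x f g = mk≋ λ n → trans (sum-cong n (λ i → *-assoc _ _ _)) (sym (sum-*ˡ n x _))

  ⊛-·ʳ : ∀ x f g → (f ⊛ (x ·ₛ g)) ≋ (x ·ₛ (f ⊛ g))
  ⊛-·ʳ x f g = mk≋ λ n → trans (sum-cong n (λ i → x-left (f i) (g (n ∸ i)))) (sym (sum-*ˡ n x _))
    where
    x-left : ∀ a b → a * (x * b) ≈ x * (a * b)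
    x-left a b = solve 3 (λ a x b → a :* (x :* b) := x :* (a :* b)) refl a x b

  one-⊛ : ∀ f → (one ⊛ f) ≋ f
  one-⊛ f = mk≋ coeff
    where
    coeff : ∀ n → (one ⊛ f) n ≈ f n
    coeff zero    = *-identityˡ _
    coeff (suc n) = trans (sum-first n _)
      (trans (+-cong (*-identityˡ _) (sum-zero n (λ i _ → zeroˡ _))) (+-identityʳ _))

  ⊛-one : ∀ f → (f ⊛ one) ≋ f
  ⊛-one f = ≋-trans (⊛-comm f one) (one-⊛ f)

  pow-+ : ∀ f a b → pow f (a ℕ.+ b) ≋ (pow f a ⊛ pow f b)
  pow-+ f a zero    rewrite ℕP.+-identityʳ a = ≋-sym (⊛-one (pow f a))
  pow-+ f a (suc b) rewrite ℕP.+-suc a b =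
    ≋-trans (⊛-cong (pow-+ f a b) (≋-refl {f})) (⊛-assoc (pow f a) (pow f b) f)

  -- Multiplication by t and by t^j.

  shift : Series → Series
  shift f zero    = 0#
  shift f (suc n) = f n

  shiftBy : ℕ → Series → Series
  shiftBy zero    f = f
  shiftBy (suc j) f = shift (shiftBy j f)

  shift-cong : ∀ {f g} → f ≋ g → shift f ≋ shift g
  shift-cong {f} {g} f≋g = mk≋ coeff
    where
    coeff : ∀ n → shift f n ≈ shift g n
    coeff zero    = refl
    coeff (suc n) = at f≋g n

  shiftBy-cong : ∀ j {f g} → f ≋ g → shiftBy j f ≋ shiftBy j g
  shiftBy-cong zero    f≋g = f≋g
  shiftBy-cong (suc j) f≋g = shift-cong (shiftBy-cong j f≋g)

  ⊛-shift : ∀ f g → (f ⊛ shift g) ≋ shift (f ⊛ g)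
  ⊛-shift f g = mk≋ coeff
    where
    coeff : ∀ n → (f ⊛ shift g) n ≈ shift (f ⊛ g) n
    coeff zero    = zeroʳ _
    coeff (suc n) = trans (+-congˡ (trans (*-congˡ (reflexive (Eq.cong (shift g) (ℕP.n∸n≡0 n)))) (zeroʳ _)))
      (trans (+-identityʳ _) (sum-cong≤ n (λ i i≤n → *-congˡ (reflexive (Eq.cong (shift g) (ℕP.+-∸-assoc 1 i≤n))))))

  ⊛-shiftBy : ∀ j f g → (f ⊛ shiftBy j g) ≋ shiftBy j (f ⊛ g)
  ⊛-shiftBy zero    f g = ≋-refl
  ⊛-shiftBy (suc j) f g = ≋-trans (⊛-shift f (shiftBy j g)) (shift-cong (⊛-shiftBy j f g))

  shiftBy-coeff : ∀ j p h → j ℕ.≤ p → shiftBy j h p ≈ h (p ∸ j)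
  shiftBy-coeff zero    p       h _         = refl
  shiftBy-coeff (suc j) (suc p) h (s≤s j≤p) = shiftBy-coeff j p h j≤p

  shiftBy-low : ∀ j p h → p ℕ.< j → shiftBy j h p ≈ 0#
  shiftBy-low (suc j) zero    h _         = refl
  shiftBy-low (suc j) (suc p) h (s≤s p<j) = shiftBy-low j p h p<j

  -- e^t - 1 = t E, hence (e^t - 1)^j = t^j E^j has no coefficients below t^j.
  expm1 : Series
  expm1 = shift E

  expm1-pow : ∀ j → pow expm1 j ≋ shiftBy j (pow E j)
  expm1-pow zero    = ≋-refl
  expm1-pow (suc j) = begin
    pow expm1 j ⊛ shift E              ≈⟨ ⊛-shift (pow expm1 j) E ⟩
    shift (pow expm1 j ⊛ E)            ≈⟨ shift-cong (⊛-cong (expm1-pow j) (≋-refl {E})) ⟩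
    shift (shiftBy j (pow E j) ⊛ E)    ≈⟨ shift-cong (⊛-comm _ E) ⟩
    shift (E ⊛ shiftBy j (pow E j))    ≈⟨ shift-cong (⊛-shiftBy j E (pow E j)) ⟩
    shift (shiftBy j (E ⊛ pow E j))    ≈⟨ shift-cong (shiftBy-cong j (⊛-comm E (pow E j))) ⟩
    shift (shiftBy j (pow E j ⊛ E))    ∎
    where open SetoidReasoning ≋-setoid

  expm1-pow-low : ∀ j q → q ℕ.< j → pow expm1 j q ≈ 0#
  expm1-pow-low j q q<j = trans (at (expm1-pow j) q) (shiftBy-low j q _ q<j)

module QAlgebra {c ℓ} (R : CommutativeRing c ℓ) (ι : ℚ → CommutativeRing.Carrier R)
                (hom : IsRingHomomorphism +-*-rawRing (CommutativeRing.rawRing R) ι) where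
  open CommutativeRing R
  open Bernoulli R ι
  open SeriesAlgebra R ι
  open IsRingHomomorphism hom using (+-homo; *-homo; 1#-homo; 0#-homo)
  open NatCoeffSolver commutativeSemiring using (solve; _:+_; _:*_; _:=_)

  nat-+ : ∀ a b → nat (a ℕ.+ b) ≈ nat a + nat b
  nat-+ a b = trans (reflexive (Eq.cong ι (natℚ-+ a b))) (+-homo (natℚ a) (natℚ b))

  nat-* : ∀ a b → nat (a ℕ.* b) ≈ nat a * nat b
  nat-* a b = trans (reflexive (Eq.cong ι (natℚ-* a b))) (*-homo (natℚ a) (natℚ b))

  nat-0 : nat 0 ≈ 0#
  nat-0 = 0#-homo

  nat-suc : ∀ a → nat (suc a) ≈ 1# + nat a
  nat-suc a = trans (nat-+ 1 a) (+-congʳ 1#-homo)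

  inverse-suc : ∀ n → ι (+ 1 ℚ./ suc n) * nat (suc n) ≈ 1#
  inverse-suc n = trans (*-comm _ _) (trans (sym (*-homo (natℚ (suc n)) _))
                    (trans (reflexive (Eq.cong ι (natℚ-inverse n))) 1#-homo))

  invFact-suc : ∀ j → nat (suc j) * ι (invFact (suc j)) ≈ ι (invFact j)
  invFact-suc j = begin
    nat (suc j) * ι (invFact j ℚ.* r)     ≈⟨ *-congˡ (*-homo (invFact j) r) ⟩
    nat (suc j) * (ι (invFact j) * ι r)   ≈⟨ solve 3 (λ n f r → n :* (f :* r) := f :* (r :* n)) refl _ _ _ ⟩
    ι (invFact j) * (ι r * nat (suc j))   ≈⟨ *-congˡ (inverse-suc j) ⟩
    ι (invFact j) * 1#                    ≈⟨ *-identityʳ _ ⟩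
    ι (invFact j)                         ∎
    where
    open SetoidReasoning setoid
    r = + 1 ℚ./ suc j

  factorial-invFact : ∀ j → nat (j !) * ι (invFact j) ≈ 1#
  factorial-invFact zero    = trans (*-congʳ 1#-homo) (trans (*-identityˡ _) 1#-homo)
  factorial-invFact (suc j) = begin
    nat (suc j ℕ.* j !) * ι (invFact (suc j))        ≈⟨ *-congʳ (nat-* (suc j) (j !)) ⟩
    nat (suc j) * nat (j !) * ι (invFact (suc j))    ≈⟨ solve 3 (λ a b d → (a :* b) :* d := b :* (a :* d)) refl _ _ _ ⟩
    nat (j !) * (nat (suc j) * ι (invFact (suc j)))  ≈⟨ *-congˡ (invFact-suc j) ⟩
    nat (j !) * ι (invFact j)                        ≈⟨ factorial-invFact j ⟩
    1#                                               ∎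
    where open SetoidReasoning setoid

  divide-factorial : ∀ j {x y} → x * nat (j !) ≈ y → x ≈ y * ι (invFact j)
  divide-factorial j {x} {y} x·j!≈y = begin
    x                                   ≈⟨ *-identityʳ x ⟨
    x * 1#                              ≈⟨ *-congˡ (factorial-invFact j) ⟨
    x * (nat (j !) * ι (invFact j))     ≈⟨ *-assoc _ _ _ ⟨
    x * nat (j !) * ι (invFact j)       ≈⟨ *-congʳ x·j!≈y ⟩
    y * ι (invFact j)                   ∎
    where open SetoidReasoning setoid

  choose-factorials-R : ∀ a b → nat ((a ℕ.+ b) C a) * nat (a !) * nat (b !) ≈ nat ((a ℕ.+ b) !)
  choose-factorials-R a b = trans (*-assoc _ _ _) (trans (*-congˡ (sym (nat-* (a !) (b !))))
    (trans (sym (nat-* ((a ℕ.+ b) C a) _)) (reflexive (Eq.cong nat (choose-factorials a b)))))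

  choose-times-factorialˡ : ∀ a b → nat ((a ℕ.+ b) C a) * nat (a !) ≈ nat ((a ℕ.+ b) !) * ι (invFact b)
  choose-times-factorialˡ a b = divide-factorial b (choose-factorials-R a b)

  choose-times-factorialʳ : ∀ a b → nat ((a ℕ.+ b) C a) * nat (b !) ≈ nat ((a ℕ.+ b) !) * ι (invFact a)
  choose-times-factorialʳ a b = divide-factorial a
    (trans (solve 3 (λ c u v → c :* v :* u := c :* u :* v) refl _ _ _) (choose-factorials-R a b))

  ∂ : Series → Series
  ∂ f n = nat (suc n) * f (suc n)

  ∂-cong : ∀ {f g} → f ≋ g → ∂ f ≋ ∂ g
  ∂-cong f≋g = mk≋ λ n → *-congˡ (at f≋g (suc n))

  ∂-⊛ : ∀ f g → ∂ (f ⊛ g) ≋ ((∂ f ⊛ g) +ₛ (f ⊛ ∂ g))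
  ∂-⊛ f g = mk≋ coeff
    where
    open SetoidReasoning setoid
    coeff : ∀ n → ∂ (f ⊛ g) n ≈ ((∂ f ⊛ g) +ₛ (f ⊛ ∂ g)) n
    coeff n = begin
      nat (suc n) * sumTo (suc n) (λ i → f i * g (suc n ∸ i))
        ≈⟨ sum-*ˡ (suc n) _ _ ⟩
      sumTo (suc n) (λ i → nat (suc n) * (f i * g (suc n ∸ i)))
        ≈⟨ sum-cong≤ (suc n) split ⟩
      sumTo (suc n) (λ i → nat i * f i * g (suc n ∸ i) + f i * (nat (suc n ∸ i) * g (suc n ∸ i)))
        ≈⟨ sum-+ (suc n) _ _ ⟩
      sumTo (suc n) (λ i → nat i * f i * g (suc n ∸ i)) + sumTo (suc n) (λ i → f i * (nat (suc n ∸ i) * g (suc n ∸ i)))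
        ≈⟨ +-cong ∂f-part f∂-part ⟩
      sumTo n (λ i → ∂ f i * g (n ∸ i)) + sumTo n (λ i → f i * ∂ g (n ∸ i)) ∎
      where
      -- n+1 = i + (n+1-i)
      split : ∀ i → i ℕ.≤ suc n → nat (suc n) * (f i * g (suc n ∸ i))
              ≈ nat i * f i * g (suc n ∸ i) + f i * (nat (suc n ∸ i) * g (suc n ∸ i))
      split i i≤ = trans (*-congʳ (trans (reflexive (Eq.cong nat (Eq.sym (ℕP.m+[n∸m]≡n i≤)))) (nat-+ i (suc n ∸ i))))
        (solve 4 (λ a b x y → (a :+ b) :* (x :* y) := a :* x :* y :+ x :* (b :* y)) refl _ _ _ _)
      -- the term i = 0 vanishes
      ∂f-part : sumTo (suc n) (λ i → nat i * f i * g (suc n ∸ i)) ≈ sumTo n (λ i → ∂ f i * g (n ∸ i))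
      ∂f-part = trans (sum-first n _)
        (trans (+-congʳ (trans (*-congʳ (trans (*-congʳ nat-0) (zeroˡ _))) (zeroˡ _))) (+-identityˡ _))
      -- the term i = n+1 vanishes
      f∂-part : sumTo (suc n) (λ i → f i * (nat (suc n ∸ i) * g (suc n ∸ i))) ≈ sumTo n (λ i → f i * ∂ g (n ∸ i))
      f∂-part = trans (+-congˡ (trans (*-congˡ (trans (*-congʳ (trans (reflexive (Eq.cong nat (ℕP.n∸n≡0 n))) nat-0))
                                                       (zeroˡ _))) (zeroʳ _)))
        (trans (+-identityʳ _) (sum-cong≤ n (λ i i≤ → *-congˡ (reflexive (Eq.cong (λ k → nat k * g k) (ℕP.+-∸-assoc 1 i≤))))))

  ∂-pow : ∀ f j → ∂ (pow f (suc j)) ≋ (nat (suc j) ·ₛ (pow f j ⊛ ∂ f))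
  ∂-pow f zero = mk≋ λ n → trans (at (∂-cong (one-⊛ f)) n)
    (sym (trans (*-congʳ 1#-homo) (trans (*-identityˡ _) (at (one-⊛ (∂ f)) n))))
  ∂-pow f (suc j) = begin
    ∂ (pow f (suc j) ⊛ f)
      ≈⟨ ∂-⊛ (pow f (suc j)) f ⟩
    (∂ (pow f (suc j)) ⊛ f) +ₛ (pow f (suc j) ⊛ ∂ f)
      ≈⟨ mk≋ (λ n → +-congʳ (at (⊛-cong (∂-pow f j) (≋-refl {f})) n)) ⟩
    ((nat (suc j) ·ₛ (pow f j ⊛ ∂ f)) ⊛ f) +ₛ (pow f (suc j) ⊛ ∂ f)
      ≈⟨ mk≋ (λ n → +-congʳ (trans (at (⊛-·ˡ _ _ f) n) (*-congˡ (at reorder n)))) ⟩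
    (nat (suc j) ·ₛ (pow f (suc j) ⊛ ∂ f)) +ₛ (pow f (suc j) ⊛ ∂ f)
      ≈⟨ mk≋ (λ n → trans (+-congˡ (sym (*-identityˡ _))) (trans (sym (distribʳ _ _ _))
                     (*-congʳ (trans (+-comm _ _) (sym (nat-suc (suc j))))))) ⟩
    nat (suc (suc j)) ·ₛ (pow f (suc j) ⊛ ∂ f) ∎
    where
    open SetoidReasoning ≋-setoid
    reorder : ((pow f j ⊛ ∂ f) ⊛ f) ≋ ((pow f j ⊛ f) ⊛ ∂ f)
    reorder = ≋-trans (⊛-assoc (pow f j) (∂ f) f)
      (≋-trans (⊛-cong (≋-refl {pow f j}) (⊛-comm (∂ f) f)) (≋-sym (⊛-assoc (pow f j) f (∂ f))))

  -- The exponential series e^(zt): the unique solution of f′ = z f, f(0) = 1.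

  power-cong : ∀ {x y} j → x ≈ y → power x j ≈ power y j
  power-cong zero    x≈y = refl
  power-cong (suc j) x≈y = *-cong (power-cong j x≈y) x≈y

  expS-cong : ∀ {x y} → x ≈ y → expS x ≋ expS y
  expS-cong x≈y = mk≋ λ n → *-congʳ (power-cong n x≈y)

  ∂-expS : ∀ x → ∂ (expS x) ≋ (x ·ₛ expS x)
  ∂-expS x = mk≋ λ n → trans (solve 4 (λ a p y b → a :* (p :* y :* b) := y :* (p :* (a :* b))) refl _ _ _ _)
    (*-congˡ (*-congˡ (invFact-suc n)))

  expS-unique : ∀ z f → (∀ n → ∂ f n ≈ z * f n) → f 0 ≈ 1# → f ≋ expS z
  expS-unique z f f′≈zf f0≈1 = mk≋ coeff
    where
    open SetoidReasoning setoid
    coeff : ∀ n → f n ≈ expS z n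
    coeff zero    = trans f0≈1 (sym (trans (*-identityˡ _) 1#-homo))
    coeff (suc n) = begin
      f (suc n)                                    ≈⟨ trans (*-congʳ (inverse-suc n)) (*-identityˡ _) ⟨
      ι r * nat (suc n) * f (suc n)                ≈⟨ *-assoc _ _ _ ⟩
      ι r * ∂ f n                                  ≈⟨ *-congˡ (f′≈zf n) ⟩
      ι r * (z * f n)                              ≈⟨ *-congˡ (*-congˡ (coeff n)) ⟩
      ι r * (z * (power z n * ι (invFact n)))      ≈⟨ solve 4 (λ a x p b → a :* (x :* (p :* b)) := p :* x :* (b :* a)) refl _ _ _ _ ⟩
      power z n * z * (ι (invFact n) * ι r)        ≈⟨ *-congˡ (*-homo (invFact n) r) ⟨
      power z n * z * ι (invFact (suc n))          ∎
      where r = + 1 ℚ./ suc n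

  expS-+ : ∀ x z → (expS x ⊛ expS z) ≋ expS (x + z)
  expS-+ x z = expS-unique (x + z) _ satisfies-ode at-zero
    where
    satisfies-ode : ∀ n → ∂ (expS x ⊛ expS z) n ≈ (x + z) * (expS x ⊛ expS z) n
    satisfies-ode n = trans (at (∂-⊛ (expS x) (expS z)) n) (trans (+-cong
      (trans (at (⊛-cong (∂-expS x) (≋-refl {expS z})) n) (at (⊛-·ˡ x (expS x) (expS z)) n))
      (trans (at (⊛-cong (≋-refl {expS x}) (∂-expS z)) n) (at (⊛-·ʳ z (expS x) (expS z)) n)))
      (sym (distribʳ _ _ _)))
    at-zero : (expS x ⊛ expS z) 0 ≈ 1#
    at-zero = trans (*-cong (trans (*-identityˡ _) 1#-homo) (trans (*-identityˡ _) 1#-homo)) (*-identityˡ _)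

  -- The binomial series  e^(zt) = Σ_j C(z,j) (e^t - 1)^j.

  ∂-expm1 : ∂ expm1 ≋ (one +ₛ expm1)
  ∂-expm1 = mk≋ coeff
    where
    coeff : ∀ n → ∂ expm1 n ≈ (one +ₛ expm1) n
    coeff zero    = trans (invFact-suc 0) (trans 1#-homo (sym (+-identityʳ _)))
    coeff (suc n) = trans (invFact-suc (suc n)) (sym (+-identityˡ _))

  ∂-expm1-pow : ∀ i n → ∂ (pow expm1 (suc i)) n ≈ nat (suc i) * (pow expm1 i n + pow expm1 (suc i) n)
  ∂-expm1-pow i n = trans (at (∂-pow expm1 i) n) (*-congˡ (begin
    (pow expm1 i ⊛ ∂ expm1) n                         ≈⟨ at (⊛-cong (≋-refl {pow expm1 i}) ∂-expm1) n ⟩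
    (pow expm1 i ⊛ (one +ₛ expm1)) n                  ≈⟨ at (⊛-distribˡ (pow expm1 i) one expm1) n ⟩
    (pow expm1 i ⊛ one) n + (pow expm1 i ⊛ expm1) n   ≈⟨ +-congʳ (at (⊛-one (pow expm1 i)) n) ⟩
    pow expm1 i n + pow expm1 (suc i) n               ∎))
    where open SetoidReasoning setoid

  binom-suc : ∀ z j → nat (suc j) * binom z (suc j) ≈ binom z j * (z - nat j)
  binom-suc z j = trans (solve 4 (λ a f w b → a :* (f :* w :* b) := f :* w :* (a :* b)) refl _ _ _ _)
    (trans (*-congˡ (invFact-suc j)) (solve 3 (λ f w b → f :* w :* b := f :* b :* w) refl _ _ _))

  binomialSeries : Carrier → Series
  binomialSeries z q = sumTo q (λ j → binom z j * pow expm1 j q)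

  ∂-binomialSeries-termwise : ∀ z n → ∂ (binomialSeries z) n
    ≈ sumTo n (λ i → binom z i * (z - nat i) * (pow expm1 i n + pow expm1 (suc i) n))
  ∂-binomialSeries-termwise z n = begin
    nat (suc n) * sumTo (suc n) (λ j → b j * u j (suc n))
      ≈⟨ sum-*ˡ (suc n) _ _ ⟩
    sumTo (suc n) (λ j → nat (suc n) * (b j * u j (suc n)))
      ≈⟨ sum-cong (suc n) (λ j → solve 3 (λ a x y → a :* (x :* y) := x :* (a :* y)) refl _ _ _) ⟩
    sumTo (suc n) (λ j → b j * ∂ (u j) n)
      ≈⟨ sum-first n _ ⟩
    b 0 * ∂ one n + sumTo n (λ i → b (suc i) * ∂ (u (suc i)) n)
      ≈⟨ +-congʳ (trans (*-congˡ (zeroʳ _)) (zeroʳ _)) ⟩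
    0# + sumTo n (λ i → b (suc i) * ∂ (u (suc i)) n)
      ≈⟨ +-identityˡ _ ⟩
    sumTo n (λ i → b (suc i) * ∂ (u (suc i)) n)
      ≈⟨ sum-cong n (λ i → trans (*-congˡ (∂-expm1-pow i n))
           (trans (solve 3 (λ x a y → x :* (a :* y) := a :* x :* y) refl _ _ _) (*-congʳ (binom-suc z i)))) ⟩
    sumTo n (λ i → b i * (z - nat i) * (u i n + u (suc i) n)) ∎
    where
    open SetoidReasoning setoid
    b = binom z
    u = pow expm1

  -- The binomial series satisfies f′ = z f: after the index shift
  -- Σ_i C(z,i)(z-i) u_(i+1) = Σ_i i C(z,i) u_i, the terms combine to z C(z,i) u_i.
  ∂-binomialSeries : ∀ z n → ∂ (binomialSeries z) n ≈ z * binomialSeries z n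
  ∂-binomialSeries z n = begin
    ∂ (binomialSeries z) n
      ≈⟨ ∂-binomialSeries-termwise z n ⟩
    sumTo n (λ i → b i * (z - nat i) * (u i n + u (suc i) n))
      ≈⟨ sum-cong n (λ i → distribˡ _ _ _) ⟩
    sumTo n (λ i → b i * (z - nat i) * u i n + b i * (z - nat i) * u (suc i) n)
      ≈⟨ sum-+ n _ _ ⟩
    sumTo n (λ i → b i * (z - nat i) * u i n) + sumTo n (λ i → b i * (z - nat i) * u (suc i) n)
      ≈⟨ +-congˡ shifted ⟩
    sumTo n (λ i → b i * (z - nat i) * u i n) + sumTo n (λ i → nat i * (b i * u i n))
      ≈⟨ sum-+ n _ _ ⟨
    sumTo n (λ i → b i * (z - nat i) * u i n + nat i * (b i * u i n))
      ≈⟨ sum-cong n (λ i → trans (solve 4 (λ x w y a → x :* w :* y :+ a :* (x :* y) := (w :+ a) :* (x :* y)) refl _ _ _ _)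
           (*-congʳ (trans (+-assoc _ _ _) (trans (+-congˡ (-‿inverseˡ _)) (+-identityʳ _))))) ⟩
    sumTo n (λ i → z * (b i * u i n))
      ≈⟨ sum-*ˡ n z _ ⟨
    z * binomialSeries z n ∎
    where
    open SetoidReasoning setoid
    b = binom z
    u = pow expm1
    shifted : sumTo n (λ i → b i * (z - nat i) * u (suc i) n) ≈ sumTo n (λ i → nat i * (b i * u i n))
    shifted = trans (sum-cong n (λ i → trans (*-congʳ (sym (binom-suc z i))) (*-assoc _ _ _)))
      (sum-shift n (λ j → nat j * (b j * u j n)) (trans (*-congʳ nat-0) (zeroˡ _))
        (trans (*-congˡ (trans (*-congˡ (expm1-pow-low (suc n) n ℕP.≤-refl)) (zeroʳ _))) (zeroʳ _)))

  binomial-series : ∀ z → binomialSeries z ≋ expS z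
  binomial-series z = expS-unique z (binomialSeries z) (∂-binomialSeries z)
    (trans (*-identityʳ _) (trans (*-identityˡ _) 1#-homo))

  binomial-series-coeff : ∀ z p q → q ℕ.≤ p → expS z q ≈ sumTo p (λ j → binom z j * pow expm1 j q)
  binomial-series-coeff z p q q≤p = trans (sym (at (binomial-series z) q))
    (sym (sum-truncate q p q≤p (λ j q<j _ → trans (*-congˡ (expm1-pow-low j q q<j)) (zeroʳ _))))

  -- Bernoulli polynomials of nonpositive order:  B_n^(-t)(x) = n! [t^n] E^t e^(xt).

  Eexp : ℕ → Carrier → Series
  Eexp t x = pow E t ⊛ expS x

  B-nonpositive : ∀ t n x → B (ℤ.- (+ t)) n x ≡ nat (n !) * Eexp t x n
  B-nonpositive zero    n x = Eq.refl
  B-nonpositive (suc t) n x = Eq.refl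

  Eexp-⊛-pow : ∀ s j x → (Eexp s x ⊛ pow E j) ≋ Eexp (s ℕ.+ j) x
  Eexp-⊛-pow s j x = begin
    (pow E s ⊛ expS x) ⊛ pow E j   ≈⟨ ⊛-assoc (pow E s) (expS x) (pow E j) ⟩
    pow E s ⊛ (expS x ⊛ pow E j)   ≈⟨ ⊛-cong (≋-refl {pow E s}) (⊛-comm (expS x) (pow E j)) ⟩
    pow E s ⊛ (pow E j ⊛ expS x)   ≈⟨ ⊛-assoc (pow E s) (pow E j) (expS x) ⟨
    (pow E s ⊛ pow E j) ⊛ expS x   ≈⟨ ⊛-cong (pow-+ E s j) (≋-refl {expS x}) ⟨
    pow E (s ℕ.+ j) ⊛ expS x       ∎
    where open SetoidReasoning ≋-setoid

  -- Expanding e^(zt) = Σ_j C(z,j) t^j E^j: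
  -- [t^p] E^s e^((x+z)t) = Σ_{j≤p} C(z,j) [t^(p-j)] E^(s+j) e^(xt).
  Eexp-translate : ∀ s p x z → Eexp s (x + z) p ≈ sumTo p (λ j → binom z j * Eexp (s ℕ.+ j) x (p ∸ j))
  Eexp-translate s p x z = begin
    (pow E s ⊛ expS (x + z)) p
      ≈⟨ at (⊛-cong (≋-refl {pow E s}) (expS-+ x z)) p ⟨
    (pow E s ⊛ (expS x ⊛ expS z)) p
      ≈⟨ at (⊛-assoc (pow E s) (expS x) (expS z)) p ⟨
    (Eexp s x ⊛ expS z) p
      ≈⟨ sum-cong≤ p (λ i i≤p → *-congˡ (binomial-series-coeff z p (p ∸ i) (ℕP.m∸n≤m p i))) ⟩
    sumTo p (λ i → Eexp s x i * sumTo p (λ j → binom z j * pow expm1 j (p ∸ i)))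
      ≈⟨ sum-cong p (λ i → trans (sum-*ˡ p (Eexp s x i) _)
           (sum-cong p (λ j → solve 3 (λ g b u → g :* (b :* u) := b :* (g :* u)) refl _ _ _))) ⟩
    sumTo p (λ i → sumTo p (λ j → binom z j * (Eexp s x i * pow expm1 j (p ∸ i))))
      ≈⟨ sum-swap p p _ ⟩
    sumTo p (λ j → sumTo p (λ i → binom z j * (Eexp s x i * pow expm1 j (p ∸ i))))
      ≈⟨ sum-cong p (λ j → sym (sum-*ˡ p (binom z j) _)) ⟩
    sumTo p (λ j → binom z j * (Eexp s x ⊛ pow expm1 j) p)
      ≈⟨ sum-cong≤ p (λ j j≤p → *-congˡ (times-expm1-pow j j≤p)) ⟩
    sumTo p (λ j → binom z j * Eexp (s ℕ.+ j) x (p ∸ j)) ∎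
    where
    open SetoidReasoning setoid
    times-expm1-pow : ∀ j → j ℕ.≤ p → (Eexp s x ⊛ pow expm1 j) p ≈ Eexp (s ℕ.+ j) x (p ∸ j)
    times-expm1-pow j j≤p = trans (at (⊛-cong (≋-refl {Eexp s x}) (expm1-pow j)) p)
      (trans (at (⊛-shiftBy j (Eexp s x) (pow E j)) p)
        (trans (shiftBy-coeff j p _ j≤p) (at (Eexp-⊛-pow s j x) (p ∸ j))))

  -- The case x = y+1, z = -y, with the summation reversed (k = p - j).
  Eexp-at-one : ∀ s p y → Eexp s 1# p ≈ sumTo p (λ k → binom (- y) (p ∸ k) * Eexp (s ℕ.+ p ∸ k) (y + 1#) k)
  Eexp-at-one s p y = begin
    Eexp s 1# p
      ≈⟨ at (⊛-cong (≋-refl {pow E s}) (expS-cong 1≈y+1-y)) p ⟩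
    Eexp s ((y + 1#) + - y) p
      ≈⟨ Eexp-translate s p (y + 1#) (- y) ⟩
    sumTo p (λ j → binom (- y) j * Eexp (s ℕ.+ j) (y + 1#) (p ∸ j))
      ≈⟨ sum-reverse p _ ⟩
    sumTo p (λ k → binom (- y) (p ∸ k) * Eexp (s ℕ.+ (p ∸ k)) (y + 1#) (p ∸ (p ∸ k)))
      ≈⟨ sum-cong≤ p (λ k k≤p → reflexive (Eq.cong₂ (λ u v → binom (- y) (p ∸ k) * Eexp u (y + 1#) v)
             (Eq.sym (ℕP.+-∸-assoc s k≤p)) (ℕP.m∸[m∸n]≡n k≤p))) ⟩
    sumTo p (λ k → binom (- y) (p ∸ k) * Eexp (s ℕ.+ p ∸ k) (y + 1#) k) ∎
    where
    open SetoidReasoning setoid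
    1≈y+1-y : 1# ≈ (y + 1#) + - y
    1≈y+1-y = sym (trans (+-congʳ (+-comm y 1#))
                (trans (+-assoc _ _ _) (trans (+-congˡ (-‿inverseʳ y)) (+-identityʳ _))))

  theorem-summand : Carrier → ℕ → ℕ → ℕ → Carrier
  theorem-summand y n m k = binom (- y) (n ∸ k ∸ m) * nat ((k ℕ.+ m ∸ 1) C k)
    * ι (invFact (k ℕ.+ m ∸ 1)) * B (+ k ℤ.- + n ℤ.+ + 1) k (y + 1#)

  summand : Carrier → ℕ → ℕ → ℕ → Carrier
  summand y s p k = binom (- y) (p ∸ k) * nat ((k ℕ.+ s) C k)
    * ι (invFact (k ℕ.+ s)) * B (ℤ.- (+ (s ℕ.+ p ∸ k))) k (y + 1#)

  theorem-summand-normal : ∀ y s p k → k ℕ.≤ p → theorem-summand y (suc (s ℕ.+ p)) (suc s) k ≡ summand y s p k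
  theorem-summand-normal y s p k k≤p
    rewrite index-binom s p k | index-choose s k | order-right (ℕP.≤-trans k≤p (ℕP.m≤n+m p s)) = Eq.refl

  -- Since C(k+s,k) k!/(k+s)! = 1/s!, each normalised summand is C(-y,p-k) [t^k] E^(s+p-k) e^((y+1)t) / s!.
  summand-Eexp : ∀ y s p k → summand y s p k ≈ ι (invFact s) * (binom (- y) (p ∸ k) * Eexp (s ℕ.+ p ∸ k) (y + 1#) k)
  summand-Eexp y s p k = begin
    b * c′ * i * B (ℤ.- (+ (s ℕ.+ p ∸ k))) k (y + 1#)
      ≡⟨ Eq.cong (b * c′ * i *_) (B-nonpositive (s ℕ.+ p ∸ k) k (y + 1#)) ⟩
    b * c′ * i * (k! * Q)
      ≈⟨ solve 5 (λ b c′ i k! Q → b :* c′ :* i :* (k! :* Q) := c′ :* k! :* i :* (b :* Q)) refl b c′ i k! Q ⟩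
    c′ * k! * i * (b * Q)
      ≈⟨ *-congʳ (*-congʳ (choose-times-factorialˡ k s)) ⟩
    nat ((k ℕ.+ s) !) * ι (invFact s) * i * (b * Q)
      ≈⟨ solve 4 (λ f s! i bQ → f :* s! :* i :* bQ := f :* i :* (s! :* bQ)) refl _ _ i _ ⟩
    nat ((k ℕ.+ s) !) * i * (ι (invFact s) * (b * Q))
      ≈⟨ *-congʳ (factorial-invFact (k ℕ.+ s)) ⟩
    1# * (ι (invFact s) * (b * Q))
      ≈⟨ *-identityˡ _ ⟩
    ι (invFact s) * (b * Q) ∎
    where
    open SetoidReasoning setoid
    b  = binom (- y) (p ∸ k)
    c′ = nat ((k ℕ.+ s) C k)
    i  = ι (invFact (k ℕ.+ s))
    k! = nat (k !)
    Q  = Eexp (s ℕ.+ p ∸ k) (y + 1#) k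

  -- The theorem with m = s+1, n = s+p+1 and its indices in normal form.
  bernoulli-identity : ∀ s p y →
    nat ((s ℕ.+ p) C s) * B (ℤ.- (+ s)) p 1# ≈ nat ((s ℕ.+ p) !) * sumTo p (summand y s p)
  bernoulli-identity s p y = begin
    nat ((s ℕ.+ p) C s) * B (ℤ.- (+ s)) p 1#
      ≡⟨ Eq.cong (nat ((s ℕ.+ p) C s) *_) (B-nonpositive s p 1#) ⟩
    nat ((s ℕ.+ p) C s) * (nat (p !) * Eexp s 1# p)
      ≈⟨ *-assoc _ _ _ ⟨
    nat ((s ℕ.+ p) C s) * nat (p !) * Eexp s 1# p
      ≈⟨ *-congʳ (choose-times-factorialʳ s p) ⟩
    nat ((s ℕ.+ p) !) * ι (invFact s) * Eexp s 1# p
      ≈⟨ *-assoc _ _ _ ⟩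
    nat ((s ℕ.+ p) !) * (ι (invFact s) * Eexp s 1# p)
      ≈⟨ *-congˡ (*-congˡ (Eexp-at-one s p y)) ⟩
    nat ((s ℕ.+ p) !) * (ι (invFact s) * sumTo p (λ k → binom (- y) (p ∸ k) * Eexp (s ℕ.+ p ∸ k) (y + 1#) k))
      ≈⟨ *-congˡ (trans (sum-*ˡ p _ _) (sum-cong p (λ k → sym (summand-Eexp y s p k)))) ⟩
    nat ((s ℕ.+ p) !) * sumTo p (summand y s p) ∎
    where open SetoidReasoning setoid

theorem14 : ∀ {c ℓ} (R : CommutativeRing c ℓ) (ι : ℚ → CommutativeRing.Carrier R) →
    IsRingHomomorphism +-*-rawRing (CommutativeRing.rawRing R) ι →
    let open CommutativeRing R
        open Bernoulli R ι
    in (a : Carrier) → ¬ (a ≈ 0#) → (m n : ℕ) → 1 ℕ.≤ m → m ℕ.≤ n →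
       nat ((n ∸ 1) C (m ∸ 1)) * B (+ 1 ℤ.- + m) (n ∸ m) 1#
         ≈ nat ((n ∸ 1) !) * sumTo (n ∸ m) (λ k →
             binom (- (a * nat n)) (n ∸ k ∸ m) * nat ((k ℕ.+ m ∸ 1) C k)
               * ι (invFact (k ℕ.+ m ∸ 1))
               * B (+ k ℤ.- + n ℤ.+ + 1) k (a * nat n + 1#))
theorem14 R ι hom a _ (suc s) n (s≤s z≤n) m≤n with ℕP.m≤n⇒∃[o]m+o≡n m≤n
... | p , Eq.refl = begin
  nat ((s ℕ.+ p) C s) * B (+ 1 ℤ.- + suc s) (s ℕ.+ p ∸ s) 1#
    ≡⟨ Eq.cong₂ (λ r q → nat ((s ℕ.+ p) C s) * B r q 1#) (order-left s) (ℕP.m+n∸m≡n s p) ⟩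
  nat ((s ℕ.+ p) C s) * B (ℤ.- (+ s)) p 1#
    ≈⟨ bernoulli-identity s p y ⟩
  nat ((s ℕ.+ p) !) * sumTo p (summand y s p)
    ≈⟨ *-congˡ (sum-cong≤ p (λ k k≤p → reflexive (theorem-summand-normal y s p k k≤p))) ⟨
  nat ((s ℕ.+ p) !) * sumTo p (theorem-summand y n′ (suc s))
    ≡⟨ Eq.cong (λ q → nat ((s ℕ.+ p) !) * sumTo q (theorem-summand y n′ (suc s))) (Eq.sym (ℕP.m+n∸m≡n s p)) ⟩
  nat ((s ℕ.+ p) !) * sumTo (s ℕ.+ p ∸ s) (theorem-summand y n′ (suc s)) ∎
  where
  open CommutativeRing R
  open Bernoulli R ι
  open SeriesAlgebra R ι using (sum-cong≤)
  open QAlgebra R ι hom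
  open SetoidReasoning setoid
  n′ = suc (s ℕ.+ p)
  y  = a * nat n′
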